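{- Let $n\ge0$, $k\ge1$ and $m\ge3$ be integers. The area of the $m$-sided polygon with vertices, in order, $V_i=(F_{n+2ik},F_{n+(2i+1)k})$ for $i=0,1,\dots,m-1$ equals $$\frac12\left|(m-1)F_kF_{2k}-F_kF_{(2m-2)k}\right|.$$ The area of the $m$-sided polygon with vertices, in order, $W_i=(L_{n+2ik},L_{n+(2i+1)k})$ for $i=0,1,\dots,m-1$ equals $$\frac52\left|(m-1)F_kF_{2k}-F_kF_{(2m-2)k}\right|.$$
   Context: $F_n$ denotes the Fibonacci numbers ($F_0=0$, $F_1=1$, $F_{n+1}=F_n+F_{n-1}$) and $L_n$ the Lucas numbers ($L_0=2$, $L_1=1$, $L_{n+1}=L_n+L_{n-1}$). The area of a polygon with vertices $(x_1,y_1),\dots,(x_m,y_m)$ taken in this order is given by the shoelace formula $\frac12\left|\sum_{i=1}^{m}(x_iy_{i+1}-x_{i+1}y_i)\right|$, indices taken mod $m$. -}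

module Defs where

open import Data.Nat as ℕ using (ℕ; zero; suc; NonZero)
open import Data.Nat.DivMod using (_%_)
open import Data.Integer as ℤ using (ℤ; +_)
open import Data.Rational as ℚ using (ℚ; _/_)
open import Data.Product using (_×_; _,_; proj₁; proj₂)
open import Data.List using (List; foldr; map; upTo)

fib : ℕ → ℕ
fib 0 = 0
fib 1 = 1
fib (suc (suc n)) = fib (suc n) ℕ.+ fib n

lucas : ℕ → ℕ
lucas 0 = 2
lucas 1 = 1
lucas (suc (suc n)) = lucas (suc n) ℕ.+ lucas n

-- A polygon with m vertices, given as a function from indices 0..m-1
-- (vertex i is  v i ; indices are interpreted mod m).
Point : Set
Point = ℤ × ℤ

shoelaceSum : (m : ℕ) → .{{NonZero m}} → (ℕ → Point) → ℤ
shoelaceSum m v = foldr ℤ._+_ (+ 0) (map term (upTo m))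
  where
  term : ℕ → ℤ
  term i = let (x₁ , y₁) = v i
               (x₂ , y₂) = v ((suc i) % m)
           in x₁ ℤ.* y₂ ℤ.- x₂ ℤ.* y₁

polygonArea : (m : ℕ) → .{{NonZero m}} → (ℕ → Point) → ℚ
polygonArea m v = (+ 1 / 2) ℚ.* ((+ ℤ.∣ shoelaceSum m v ∣) / 1)

-- Every sequence G with G(j+2) = G(j+1) + G(j) satisfies Vajda's identity
--   G(a+i) G(a+j) - G(a) G(a+i+j) = F(i) F(j) E(a),
-- where E(a) = G(a+1)^2 - G(a+1) G(a) - G(a)^2 only changes sign as a increases.
-- Consecutive vertices V_i, V_{i+1} start at a = n + 2ik, so each of the first
-- m - 1 shoelace terms equals -F(k) F(2k) E(n), while the closing term is
-- F((2m-2)k) F(k) E(n).  Hence the shoelace sum is -E(n) times the bracket of the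
-- theorem, and |E| is 1 for the Fibonacci and 5 for the Lucas numbers.
module Submission where

open import Data.Nat as ℕ using (ℕ; zero; suc; _≥_; _∸_; _<_)
import Data.Nat.Properties as ℕP
import Data.Nat.Tactic.RingSolver as ℕ-Solver
open import Data.Nat.DivMod using (m<n⇒m%n≡m; n%n≡0)
open import Data.Integer as ℤ using (ℤ; +_; _+_; _*_; _-_; -_; ∣_∣)
import Data.Integer.Properties as ℤP
open import Data.Integer.Tactic.RingSolver using (solve-∀)
open import Data.Rational as ℚ using (_/_)
open import Data.Rational.Properties using (toℚᵘ-injective; toℚᵘ-homo-*; toℚᵘ-fromℚᵘ)
import Data.Rational.Unnormalised as ℚᵘ
import Data.Rational.Unnormalised.Properties as ℚᵘP
open import Data.List using (foldr; map; applyUpTo)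
open import Data.Product using (_×_; _,_)
open import Function using (_∘_)
open import Relation.Binary.PropositionalEquality
open import Defs

½*[c*x]≡[c/2]*x : ∀ c x → (+ 1 / 2) ℚ.* ((+ (c ℕ.* x)) / 1) ≡ (+ c / 2) ℚ.* ((+ x) / 1)
½*[c*x]≡[c/2]*x c x = toℚᵘ-injective (begin
  ℚ.toℚᵘ ((+ 1 / 2) ℚ.* ((+ (c ℕ.* x)) / 1))
    ≈⟨ toℚᵘ-homo-* (+ 1 / 2) ((+ (c ℕ.* x)) / 1) ⟩
  ℚ.toℚᵘ (+ 1 / 2) ℚᵘ.* ℚ.toℚᵘ ((+ (c ℕ.* x)) / 1)
    ≈⟨ ℚᵘP.*-cong (toℚᵘ-fromℚᵘ (ℚᵘ.mkℚᵘ (+ 1) 1)) (toℚᵘ-fromℚᵘ (ℚᵘ.mkℚᵘ (+ (c ℕ.* x)) 0)) ⟩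
  ℚᵘ.mkℚᵘ (+ 1) 1 ℚᵘ.* ℚᵘ.mkℚᵘ (+ (c ℕ.* x)) 0
    ≈⟨ ℚᵘ.*≡* (cong (ℤ._* + 2) numerator) ⟩
  ℚᵘ.mkℚᵘ (+ c) 1 ℚᵘ.* ℚᵘ.mkℚᵘ (+ x) 0
    ≈⟨ ℚᵘP.*-cong (toℚᵘ-fromℚᵘ (ℚᵘ.mkℚᵘ (+ c) 1)) (toℚᵘ-fromℚᵘ (ℚᵘ.mkℚᵘ (+ x) 0)) ⟨
  ℚ.toℚᵘ (+ c / 2) ℚᵘ.* ℚ.toℚᵘ ((+ x) / 1)
    ≈⟨ toℚᵘ-homo-* (+ c / 2) ((+ x) / 1) ⟨
  ℚ.toℚᵘ ((+ c / 2) ℚ.* ((+ x) / 1)) ∎)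
  where
  open ℚᵘP.≃-Reasoning
  numerator : + 1 * + (c ℕ.* x) ≡ + c * + x
  numerator = trans (ℤP.*-identityˡ _) (ℤP.pos-* c x)

open ≡-Reasoning

fibℤ : ℕ → ℤ
fibℤ j = + fib j

record Gibonacci (G : ℕ → ℤ) : Set where
  constructor gibonacci
  field recurrence : ∀ j → G (suc (suc j)) ≡ G (suc j) + G j
open Gibonacci

fibℤ-gibonacci : Gibonacci fibℤ
fibℤ-gibonacci = gibonacci λ _ → refl

lucasℤ-gibonacci : Gibonacci (+_ ∘ lucas)
lucasℤ-gibonacci = gibonacci λ _ → refl

shift-gibonacci : ∀ {G} → Gibonacci G → ∀ a → Gibonacci (G ∘ (a ℕ.+_))
shift-gibonacci {G} rec a = gibonacci λ j → begin
  G (a ℕ.+ suc (suc j))             ≡⟨ cong G (ℕP.+-suc a (suc j)) ⟩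
  G (suc (a ℕ.+ suc j))             ≡⟨ cong (G ∘ suc) (ℕP.+-suc a j) ⟩
  G (suc (suc (a ℕ.+ j)))           ≡⟨ recurrence rec (a ℕ.+ j) ⟩
  G (suc (a ℕ.+ j)) + G (a ℕ.+ j)   ≡⟨ cong (λ b → G b + G (a ℕ.+ j)) (ℕP.+-suc a j) ⟨
  G (a ℕ.+ suc j) + G (a ℕ.+ j)     ∎

u₀≡0⇒uᵢ≡Fᵢ*u₁ : ∀ {u} → Gibonacci u → u 0 ≡ + 0 → ∀ i → u i ≡ fibℤ i * u 1
u₀≡0⇒uᵢ≡Fᵢ*u₁ rec u₀≡0 zero = u₀≡0
u₀≡0⇒uᵢ≡Fᵢ*u₁ {u} rec u₀≡0 (suc zero) = sym (ℤP.*-identityˡ (u 1))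
u₀≡0⇒uᵢ≡Fᵢ*u₁ {u} rec u₀≡0 (suc (suc i)) = begin
  u (suc (suc i))                     ≡⟨ recurrence rec i ⟩
  u (suc i) + u i                     ≡⟨ cong₂ _+_ (induct (suc i)) (induct i) ⟩
  fibℤ (suc i) * u 1 + fibℤ i * u 1   ≡⟨ ℤP.*-distribʳ-+ (u 1) (fibℤ (suc i)) (fibℤ i) ⟨
  fibℤ (suc (suc i)) * u 1            ∎
  where
  induct : ∀ i → u i ≡ fibℤ i * u 1
  induct = u₀≡0⇒uᵢ≡Fᵢ*u₁ rec u₀≡0

characteristic : (ℕ → ℤ) → ℕ → ℤ
characteristic G a = G (suc a) * G (suc a) - G (suc a) * G a - G a * G a

characteristic-shift : ∀ G a → characteristic (G ∘ (a ℕ.+_)) 0 ≡ characteristic G a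
characteristic-shift G a =
  cong₂ (λ x y → y * y - y * x - x * x) (cong G (ℕP.+-identityʳ a)) (cong G (ℕP.+-comm a 1))

module _ {G : ℕ → ℤ} (rec : Gibonacci G) where

  characteristic-suc : ∀ a → characteristic G (suc a) ≡ - characteristic G a
  characteristic-suc a = begin
    characteristic G (suc a)                  ≡⟨ cong (λ z → z * z - z * y - y * y) (recurrence rec a) ⟩
    (y + x) * (y + x) - (y + x) * y - y * y   ≡⟨ expand x y ⟩
    - characteristic G a                      ∎
    where
    x = G a
    y = G (suc a)
    expand : ∀ x y → (y + x) * (y + x) - (y + x) * y - y * y ≡ - (y * y - y * x - x * x)
    expand = solve-∀

  characteristic-+2* : ∀ a t → characteristic G (a ℕ.+ 2 ℕ.* t) ≡ characteristic G a
  characteristic-+2* a zero = cong (characteristic G) (ℕP.+-identityʳ a)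
  characteristic-+2* a (suc t) = begin
    characteristic G (a ℕ.+ 2 ℕ.* suc t)           ≡⟨ cong (characteristic G) (index a t) ⟩
    characteristic G (suc (suc (a ℕ.+ 2 ℕ.* t)))   ≡⟨ characteristic-suc _ ⟩
    - characteristic G (suc (a ℕ.+ 2 ℕ.* t))       ≡⟨ cong -_ (characteristic-suc _) ⟩
    - - characteristic G (a ℕ.+ 2 ℕ.* t)           ≡⟨ ℤP.neg-involutive _ ⟩
    characteristic G (a ℕ.+ 2 ℕ.* t)               ≡⟨ characteristic-+2* a t ⟩
    characteristic G a                             ∎
    where
    index : ∀ a t → a ℕ.+ 2 ℕ.* suc t ≡ suc (suc (a ℕ.+ 2 ℕ.* t))
    index = ℕ-Solver.solve-∀

  ∣characteristic∣-constant : ∀ a → ∣ characteristic G a ∣ ≡ ∣ characteristic G 0 ∣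
  ∣characteristic∣-constant zero = refl
  ∣characteristic∣-constant (suc a) = begin
    ∣ characteristic G (suc a) ∣   ≡⟨ cong ∣_∣ (characteristic-suc a) ⟩
    ∣ - characteristic G a ∣       ≡⟨ ℤP.∣-i∣≡∣i∣ (characteristic G a) ⟩
    ∣ characteristic G a ∣         ≡⟨ ∣characteristic∣-constant a ⟩
    ∣ characteristic G 0 ∣         ∎

  -- For fixed j the left-hand side is a Gibonacci sequence in i vanishing at i = 0,
  -- hence F(i) times its value at i = 1; by the symmetry in i and j, that value is
  -- F(j) times the value at i = j = 1, which is E(0).
  vajda₀ : ∀ i j → G i * G j - G 0 * G (i ℕ.+ j) ≡ fibℤ i * fibℤ j * characteristic G 0
  vajda₀ i j = begin
    V j i                                     ≡⟨ u₀≡0⇒uᵢ≡Fᵢ*u₁ (V-gibonacci j) (V-zero j) i ⟩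
    fibℤ i * V j 1                            ≡⟨ cong (fibℤ i *_) V-one ⟩
    fibℤ i * (fibℤ j * characteristic G 0)    ≡⟨ ℤP.*-assoc (fibℤ i) (fibℤ j) _ ⟨
    fibℤ i * fibℤ j * characteristic G 0      ∎
    where
    V : ℕ → ℕ → ℤ
    V j i = G i * G j - G 0 * G (i ℕ.+ j)

    V-zero : ∀ j → V j 0 ≡ + 0
    V-zero j = ℤP.+-inverseʳ (G 0 * G j)

    V-gibonacci : ∀ j → Gibonacci (V j)
    V-gibonacci j = gibonacci λ i → begin
      V j (suc (suc i))
        ≡⟨ cong₂ (λ a b → a * G j - G 0 * b) (recurrence rec i) (recurrence rec (i ℕ.+ j)) ⟩
      (G (suc i) + G i) * G j - G 0 * (G (suc (i ℕ.+ j)) + G (i ℕ.+ j))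
        ≡⟨ split (G (suc i)) (G i) (G j) (G 0) (G (suc (i ℕ.+ j))) (G (i ℕ.+ j)) ⟩
      V j (suc i) + V j i ∎
      where
      split : ∀ a b c d e f → (a + b) * c - d * (e + f) ≡ (a * c - d * e) + (b * c - d * f)
      split = solve-∀

    V-one-one : V 1 1 ≡ characteristic G 0
    V-one-one = begin
      G 1 * G 1 - G 0 * G 2              ≡⟨ cong (λ z → G 1 * G 1 - G 0 * z) (recurrence rec 0) ⟩
      G 1 * G 1 - G 0 * (G 1 + G 0)      ≡⟨ expand (G 0) (G 1) ⟩
      characteristic G 0                 ∎
      where
      expand : ∀ x y → y * y - x * (y + x) ≡ y * y - y * x - x * x
      expand = solve-∀

    V-one : V j 1 ≡ fibℤ j * characteristic G 0
    V-one = begin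
      V j 1                            ≡⟨ cong₂ (λ a b → a - G 0 * G b) (ℤP.*-comm (G 1) (G j)) (ℕP.+-comm 1 j) ⟩
      V 1 j                            ≡⟨ u₀≡0⇒uᵢ≡Fᵢ*u₁ (V-gibonacci 1) (V-zero 1) j ⟩
      fibℤ j * V 1 1                   ≡⟨ cong (fibℤ j *_) V-one-one ⟩
      fibℤ j * characteristic G 0      ∎

vajda : ∀ {G} → Gibonacci G → ∀ a i j → G (a ℕ.+ i) * G (a ℕ.+ j) - G a * G (a ℕ.+ i ℕ.+ j)
        ≡ fibℤ i * fibℤ j * characteristic G a
vajda {G} rec a i j = begin
  G (a ℕ.+ i) * G (a ℕ.+ j) - G a * G (a ℕ.+ i ℕ.+ j)
    ≡⟨ cong₂ (λ b c → G (a ℕ.+ i) * G (a ℕ.+ j) - G b * G c) (ℕP.+-identityʳ a) (sym (ℕP.+-assoc a i j)) ⟨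
  G (a ℕ.+ i) * G (a ℕ.+ j) - G (a ℕ.+ 0) * G (a ℕ.+ (i ℕ.+ j))
    ≡⟨ vajda₀ (shift-gibonacci rec a) i j ⟩
  fibℤ i * fibℤ j * characteristic (G ∘ (a ℕ.+_)) 0
    ≡⟨ cong (fibℤ i * fibℤ j *_) (characteristic-shift G a) ⟩
  fibℤ i * fibℤ j * characteristic G a ∎

cross : Point → Point → ℤ
cross (x₁ , y₁) (x₂ , y₂) = x₁ * y₂ - x₂ * y₁

sumUpTo : (ℕ → ℤ) → ℕ → ℤ
sumUpTo f zero = + 0
sumUpTo f (suc p) = sumUpTo f p + f p

sumUpTo-suc-shift : ∀ f p → sumUpTo f (suc p) ≡ f 0 + sumUpTo (f ∘ suc) p
sumUpTo-suc-shift f zero = trans (ℤP.+-identityˡ (f 0)) (sym (ℤP.+-identityʳ (f 0)))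
sumUpTo-suc-shift f (suc p) =
  trans (cong (_+ f (suc p)) (sumUpTo-suc-shift f p)) (ℤP.+-assoc (f 0) _ _)

foldr-+-applyUpTo : ∀ (f : ℕ → ℤ) (g : ℕ → ℕ) p →
  foldr _+_ (+ 0) (map f (applyUpTo g p)) ≡ sumUpTo (f ∘ g) p
foldr-+-applyUpTo f g zero = refl
foldr-+-applyUpTo f g (suc p) =
  trans (cong (λ s → f (g 0) + s) (foldr-+-applyUpTo f (g ∘ suc) p)) (sym (sumUpTo-suc-shift (f ∘ g) p))

sumUpTo-cong : ∀ {f g} p → (∀ i → i < p → f i ≡ g i) → sumUpTo f p ≡ sumUpTo g p
sumUpTo-cong zero f≡g = refl
sumUpTo-cong (suc p) f≡g =
  cong₂ _+_ (sumUpTo-cong p (λ i i<p → f≡g i (ℕP.m<n⇒m<1+n i<p))) (f≡g p ℕP.≤-refl)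

sumUpTo-const : ∀ c p → sumUpTo (λ _ → c) p ≡ + p * c
sumUpTo-const c zero = sym (ℤP.*-zeroˡ c)
sumUpTo-const c (suc p) = begin
  sumUpTo (λ _ → c) p + c   ≡⟨ cong (_+ c) (sumUpTo-const c p) ⟩
  + p * c + c               ≡⟨ ℤP.+-comm (+ p * c) c ⟩
  c + + p * c               ≡⟨ ℤP.suc-* (+ p) c ⟨
  + suc p * c               ∎

shoelaceSum-suc : ∀ p v →
  shoelaceSum (suc p) v ≡ sumUpTo (λ i → cross (v i) (v (suc i))) p + cross (v p) (v 0)
shoelaceSum-suc p v = begin
  shoelaceSum (suc p) v                     ≡⟨ foldr-+-applyUpTo term (λ i → i) (suc p) ⟩
  sumUpTo term p + term p                   ≡⟨ cong₂ _+_ (sumUpTo-cong p interior) closing ⟩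
  sumUpTo (λ i → cross (v i) (v (suc i))) p + cross (v p) (v 0) ∎
  where
  term : ℕ → ℤ
  term i = cross (v i) (v (suc i ℕ.% suc p))
  interior : ∀ i → i < p → term i ≡ cross (v i) (v (suc i))
  interior i i<p = cong (cross (v i) ∘ v) (m<n⇒m%n≡m (ℕ.s≤s i<p))
  closing : term p ≡ cross (v p) (v 0)
  closing = cong (cross (v p) ∘ v) (n%n≡0 (suc p))

Δ : ℕ → ℕ → ℤ
Δ k m = + (m ∸ 1) * fibℤ k * fibℤ (2 ℕ.* k) - fibℤ k * fibℤ ((2 ℕ.* m ∸ 2) ℕ.* k)

module GibonacciPolygon {G : ℕ → ℤ} (rec : Gibonacci G) (n k : ℕ) where

  corner : ℕ → ℕ
  corner i = n ℕ.+ 2 ℕ.* i ℕ.* k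

  vertex : ℕ → Point
  vertex i = G (corner i) , G (n ℕ.+ (2 ℕ.* i ℕ.+ 1) ℕ.* k)

  vertex-≡ : ∀ i → vertex i ≡ (G (corner i) , G (corner i ℕ.+ k))
  vertex-≡ i = cong (λ b → G (corner i) , G b) (index n i k)
    where
    index : ∀ n i k → n ℕ.+ (2 ℕ.* i ℕ.+ 1) ℕ.* k ≡ n ℕ.+ 2 ℕ.* i ℕ.* k ℕ.+ k
    index = ℕ-Solver.solve-∀

  vertex-suc-≡ : ∀ i → vertex (suc i) ≡ (G (corner i ℕ.+ 2 ℕ.* k) , G (corner i ℕ.+ k ℕ.+ 2 ℕ.* k))
  vertex-suc-≡ i = cong₂ (λ b c → G b , G c) (index₁ n i k) (index₂ n i k)
    where
    index₁ : ∀ n i k → n ℕ.+ 2 ℕ.* suc i ℕ.* k ≡ n ℕ.+ 2 ℕ.* i ℕ.* k ℕ.+ 2 ℕ.* k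
    index₁ = ℕ-Solver.solve-∀
    index₂ : ∀ n i k → n ℕ.+ (2 ℕ.* suc i ℕ.+ 1) ℕ.* k ≡ n ℕ.+ 2 ℕ.* i ℕ.* k ℕ.+ k ℕ.+ 2 ℕ.* k
    index₂ = ℕ-Solver.solve-∀

  vertex-zero-≡ : vertex 0 ≡ (G n , G (n ℕ.+ k))
  vertex-zero-≡ = trans (vertex-≡ 0) (cong (λ b → G b , G (b ℕ.+ k)) (ℕP.+-identityʳ n))

  cross-vertex-suc : ∀ i → cross (vertex i) (vertex (suc i)) ≡ - (fibℤ k * fibℤ (2 ℕ.* k) * characteristic G n)
  cross-vertex-suc i = begin
    cross (vertex i) (vertex (suc i))
      ≡⟨ cong₂ cross (vertex-≡ i) (vertex-suc-≡ i) ⟩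
    G a * G (a ℕ.+ k ℕ.+ 2 ℕ.* k) - G (a ℕ.+ 2 ℕ.* k) * G (a ℕ.+ k)
      ≡⟨ flip (G a) (G (a ℕ.+ k)) (G (a ℕ.+ 2 ℕ.* k)) (G (a ℕ.+ k ℕ.+ 2 ℕ.* k)) ⟩
    - (G (a ℕ.+ k) * G (a ℕ.+ 2 ℕ.* k) - G a * G (a ℕ.+ k ℕ.+ 2 ℕ.* k))
      ≡⟨ cong -_ (vajda rec a k (2 ℕ.* k)) ⟩
    - (fibℤ k * fibℤ (2 ℕ.* k) * characteristic G a)
      ≡⟨ cong (λ e → - (fibℤ k * fibℤ (2 ℕ.* k) * e)) characteristic-corner ⟩
    - (fibℤ k * fibℤ (2 ℕ.* k) * characteristic G n) ∎
    where
    a = corner i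
    flip : ∀ w x y z → w * z - y * x ≡ - (x * y - w * z)
    flip = solve-∀
    characteristic-corner : characteristic G a ≡ characteristic G n
    characteristic-corner =
      trans (cong (characteristic G ∘ (n ℕ.+_)) (ℕP.*-assoc 2 i k)) (characteristic-+2* rec n (i ℕ.* k))

  cross-vertex-zero : ∀ p → cross (vertex p) (vertex 0) ≡ fibℤ (2 ℕ.* p ℕ.* k) * fibℤ k * characteristic G n
  cross-vertex-zero p = trans (cong₂ cross (vertex-≡ p) vertex-zero-≡) (vajda rec n (2 ℕ.* p ℕ.* k) k)

  shoelaceSum-vertex : ∀ p → shoelaceSum (suc p) vertex ≡ - (characteristic G n * Δ k (suc p))
  shoelaceSum-vertex p = begin
    shoelaceSum (suc p) vertex
      ≡⟨ shoelaceSum-suc p vertex ⟩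
    sumUpTo (λ i → cross (vertex i) (vertex (suc i))) p + cross (vertex p) (vertex 0)
      ≡⟨ cong₂ _+_ (trans (sumUpTo-cong p (λ i _ → cross-vertex-suc i)) (sumUpTo-const _ p)) (cross-vertex-zero p) ⟩
    + p * - (fibℤ k * fibℤ (2 ℕ.* k) * e) + fibℤ (2 ℕ.* p ℕ.* k) * fibℤ k * e
      ≡⟨ cong (λ j → + p * - (fibℤ k * fibℤ (2 ℕ.* k) * e) + fibℤ j * fibℤ k * e) last-index ⟨
    + p * - (fibℤ k * fibℤ (2 ℕ.* k) * e) + fibℤ ((2 ℕ.* suc p ∸ 2) ℕ.* k) * fibℤ k * e
      ≡⟨ collect (+ p) (fibℤ k) (fibℤ (2 ℕ.* k)) (fibℤ ((2 ℕ.* suc p ∸ 2) ℕ.* k)) e ⟩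
    - (e * Δ k (suc p)) ∎
    where
    e = characteristic G n
    last-index : (2 ℕ.* suc p ∸ 2) ℕ.* k ≡ 2 ℕ.* p ℕ.* k
    last-index = cong (λ q → (q ∸ 2) ℕ.* k) (ℕP.*-distribˡ-+ 2 1 p)
    collect : ∀ P a b c e → P * - (a * b * e) + c * a * e ≡ - (e * (P * a * b - a * c))
    collect = solve-∀

  ∣shoelaceSum-vertex∣ : ∀ p → ∣ shoelaceSum (suc p) vertex ∣ ≡ ∣ characteristic G 0 ∣ ℕ.* ∣ Δ k (suc p) ∣
  ∣shoelaceSum-vertex∣ p = begin
    ∣ shoelaceSum (suc p) vertex ∣ ≡⟨ cong ∣_∣ (shoelaceSum-vertex p) ⟩
    ∣ - (e * Δ k (suc p)) ∣        ≡⟨ ℤP.∣-i∣≡∣i∣ (e * Δ k (suc p)) ⟩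
    ∣ e * Δ k (suc p) ∣            ≡⟨ ℤP.abs-* e (Δ k (suc p)) ⟩
    ∣ e ∣ ℕ.* ∣ Δ k (suc p) ∣      ≡⟨ cong (ℕ._* ∣ Δ k (suc p) ∣) (∣characteristic∣-constant rec n) ⟩
    ∣ characteristic G 0 ∣ ℕ.* ∣ Δ k (suc p) ∣ ∎
    where
    e = characteristic G n

theorem3p1 : (n k m : ℕ) → k ≥ 1 → (m≥3 : m ≥ 3) →
    let instance _ = ℕ.>-nonZero (ℕP.≤-trans (ℕ.s≤s ℕ.z≤n) m≥3)
        D = (+ (m ∸ 1)) ℤ.* (+ fib k) ℤ.* (+ fib (2 ℕ.* k))
            ℤ.- (+ fib k) ℤ.* (+ fib ((2 ℕ.* m ∸ 2) ℕ.* k))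
    in (polygonArea m (λ i → (+ fib (n ℕ.+ 2 ℕ.* i ℕ.* k)) , (+ fib (n ℕ.+ (2 ℕ.* i ℕ.+ 1) ℕ.* k)))
          ≡ (+ 1 / 2) ℚ.* ((+ ℤ.∣ D ∣) / 1))
     × (polygonArea m (λ i → (+ lucas (n ℕ.+ 2 ℕ.* i ℕ.* k)) , (+ lucas (n ℕ.+ (2 ℕ.* i ℕ.+ 1) ℕ.* k)))
          ≡ (+ 5 / 2) ℚ.* ((+ ℤ.∣ D ∣) / 1))
theorem3p1 n k (suc p) _ _ =
    cong half-over-1 (trans (Fibonacci.∣shoelaceSum-vertex∣ p) (ℕP.*-identityˡ ∣ Δ k (suc p) ∣))
  , trans (cong half-over-1 (Lucas.∣shoelaceSum-vertex∣ p)) (½*[c*x]≡[c/2]*x 5 ∣ Δ k (suc p) ∣)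
  where
  module Fibonacci = GibonacciPolygon fibℤ-gibonacci n k
  module Lucas = GibonacciPolygon lucasℤ-gibonacci n k
  half-over-1 : ℕ → ℚ.ℚ
  half-over-1 z = (+ 1 / 2) ℚ.* ((+ z) / 1)
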